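{- For all contexts $\Gamma,\Delta$, terms $M, A$ and substitution $\sigma$: if $\sigma:\Gamma\rightharpoonup\Delta$, $\Delta\ \mathrm{ok}$ and $\Gamma\vdash M:A$, then $\Delta\vdash M\bullet\sigma:A\bullet\sigma$.
   Context: Variables $\mathcal{V}$: a type with decidable equality and maps $\mathrm{encode}:\mathcal{V}\to\mathbb{N}$, $\mathrm{decode}:\mathbb{N}\to\mathcal{V}$ with $\mathrm{encode}(\mathrm{decode}\,n)=n$. Constants $\mathcal{C}$: any type. Terms: $\mathsf{c}\,k$, $\mathsf{v}\,x$, $\lambda[x:A]M$, $\Pi[x:A]B$, $M\cdot N$. Free-variable list: $\mathrm{fv}(\mathsf{c}\,k)=[\,]$, $\mathrm{fv}(\mathsf{v}\,x)=[x]$, $\mathrm{fv}(\lambda[x:A]M)=\mathrm{fv}\,A\mathbin{++}(\mathrm{fv}\,M-x)$, likewise $\Pi$, $\mathrm{fv}(M\cdot N)=\mathrm{fv}\,M\mathbin{++}\mathrm{fv}\,N$ ($xs-x$ removes all occurrences of $x$). Substitutions $\sigma:\mathcal{V}\to\Lambda$; $\iota\,x=\mathsf{v}\,x$; $(\sigma,x:=N)$ sends $x$ to $N$, $y\neq x$ to $\sigma\,y$. Fix $\chi':\mathrm{List}\,\mathbb{N}\to\mathbb{N}$ with $\chi'(ns)\notin ns$; $X'(xs)=\mathrm{decode}(\chi'(\mathrm{map\ encode}\ xs))$; $X(\sigma,xs)=X'$(concatenation of $\mathrm{fv}(\sigma\,y)$ for $y$ in $xs$). Substitution: $\mathsf{c}\,k\bullet\sigma=\mathsf{c}\,k$,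 $\mathsf{v}\,x\bullet\sigma=\sigma\,x$, $(M\cdot N)\bullet\sigma=(M\bullet\sigma)\cdot(N\bullet\sigma)$, $(\lambda[x:A]M)\bullet\sigma=\lambda[y:A\bullet\sigma](M\bullet(\sigma,x:=\mathsf{v}\,y))$ with $y=X(\sigma,\mathrm{fv}\,M-x)$, analogously for $\Pi$ (with $y=X(\sigma,\mathrm{fv}\,B-x)$). $M[x:=N]=M\bullet(\iota,x:=N)$. Alpha-conversion $\sim_\alpha$: inductive, $\mathsf{c}\,k\sim_\alpha\mathsf{c}\,k$, $\mathsf{v}\,x\sim_\alpha\mathsf{v}\,x$, congruence for application, and $\lambda[x:A]M\sim_\alpha\lambda[x':A']M'$ whenever $A\sim_\alpha A'$, $y\notin\mathrm{fv}\,M-x$, $y\notin\mathrm{fv}\,M'-x'$ and $M[x:=\mathsf{v}\,y]=M'[x':=\mathsf{v}\,y]$ syntactically, for some $y$ (same for $\Pi$). Beta: the contextual closure of a relation $S$ is the least relation containing $S$ and closed under rewriting in the body or annotation of $\lambda$, in the codomain or domain of $\Pi$, and in either side of an application; $\to_\beta$ is the contextual closure of $(\lambda[x:A]M)\cdot N\ \triangleright\ M[x:=N]$; $\simeq_\beta$ is the reflexive–symmetric–transitive closure of $\sim_\alpha\cup\to_\beta$. PTS: fix $\mathcal{A}\subseteq\mathcal{C}^2$ (axioms) and $\mathcal{R}\subseteq\mathcal{C}^3$ (rules). A context is a list of pairs $(x,A)$; $\Gamma,x:A$ denotes $(x,A)::\Gamma$; $\mathrm{dom}\,\Gamma$ is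 the list of first components. The judgments $\Gamma\ \mathrm{ok}$ and $\Gamma\vdash M:A$ are mutually inductively defined by: (nil) $[\,]\ \mathrm{ok}$; (cons) if $\Gamma\ \mathrm{ok}$, $\Gamma\vdash A:\mathsf{c}\,s$ and $x\notin\mathrm{dom}\,\Gamma$ then $(\Gamma,x:A)\ \mathrm{ok}$; (sort) if $\Gamma\ \mathrm{ok}$ and $\mathcal{A}\,s_1\,s_2$ then $\Gamma\vdash\mathsf{c}\,s_1:\mathsf{c}\,s_2$; (prod) if $\Gamma\vdash A:\mathsf{c}\,s_1$, for every $y\notin\mathrm{dom}\,\Gamma$ we have $\Gamma,y:A\vdash B[x:=\mathsf{v}\,y]:\mathsf{c}\,s_2$, and $\mathcal{R}\,s_1\,s_2\,s_3$, then $\Gamma\vdash\Pi[x:A]B:\mathsf{c}\,s_3$; (var) if $\Gamma\ \mathrm{ok}$ and $(x,A)\in\Gamma$ then $\Gamma\vdash\mathsf{v}\,x:A$; (abs) if $\Gamma\vdash A:\mathsf{c}\,s_1$, for every $z\notin\mathrm{dom}\,\Gamma$ both $\Gamma,z:A\vdash B[y:=\mathsf{v}\,z]:\mathsf{c}\,s_2$ and $\Gamma,z:A\vdash M[x:=\mathsf{v}\,z]:B[y:=\mathsf{v}\,z]$, and $\mathcal{R}\,s_1\,s_2\,s_3$, then $\Gamma\vdash\lambda[x:A]M:\Pi[y:A]B$; (app) if $\Gamma\vdash M:\Pi[x:A]B$, $\Gamma\vdash N:A$ and $\Gamma\vdash B[x:=N]:\mathsf{c}\,s$, then $\Gamma\vdash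 M\cdot N:B[x:=N]$; (conv) if $\Gamma\vdash M:A$, $A\simeq_\beta B$ and $\Gamma\vdash B:\mathsf{c}\,s$ then $\Gamma\vdash M:B$. A substitution $\sigma$ is well-typed from $\Gamma$ to $\Delta$, written $\sigma:\Gamma\rightharpoonup\Delta$, if for every $(x,A)\in\Gamma$ we have $\Delta\vdash\sigma\,x:A\bullet\sigma$. -}

module Defs where

open import Level using (0ℓ)
open import Data.Nat using (ℕ)
open import Data.List using (List; []; _∷_; _++_; map; concatMap)
open import Data.List.Membership.Propositional using (_∈_; _∉_)
open import Data.Product using (_×_; _,_; proj₁)
open import Relation.Nullary using (¬_; yes; no)
open import Relation.Binary using (Rel; DecidableEquality)
open import Relation.Binary.PropositionalEquality using (_≡_)
open import Relation.Binary.Construct.Union using (_∪_)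
open import Relation.Binary.Construct.Closure.Equivalence using (EqClosure)

module PTS (V : Set) (_≟_ : DecidableEquality V)
           (encode : V → ℕ) (decode : ℕ → V)
           (encode-decode : ∀ n → encode (decode n) ≡ n)
           (C : Set)
           (χ' : List ℕ → ℕ) (χ'-fresh : ∀ ns → χ' ns ∉ ns)
           (𝒜 : C → C → Set) (ℛ : C → C → C → Set) where

  infixl 7 _·_
  infix 8 _[_:=_]
  infix 2 _⊢_∶_
  infix 2 _∶_⇀_
  infix 3 _≃β_
  infix 3 _∼α_

  data Λ : Set where
    c    : C → Λ
    v    : V → Λ
    ƛ[_∶_]_ : V → Λ → Λ → Λ
    Π[_∶_]_ : V → Λ → Λ → Λ
    _·_  : Λ → Λ → Λ

  _-_ : List V → V → List V
  [] - x = []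
  (y ∷ ys) - x with y ≟ x
  ... | yes _ = ys - x
  ... | no  _ = y ∷ (ys - x)

  fv : Λ → List V
  fv (c k) = []
  fv (v x) = x ∷ []
  fv (ƛ[ x ∶ A ] M) = fv A ++ (fv M - x)
  fv (Π[ x ∶ A ] B) = fv A ++ (fv B - x)
  fv (M · N) = fv M ++ fv N

  Subst : Set
  Subst = V → Λ

  ι : Subst
  ι x = v x

  _,_:=_ : Subst → V → Λ → Subst
  (σ , x := N) y with y ≟ x
  ... | yes _ = N
  ... | no  _ = σ y

  X' : List V → V
  X' xs = decode (χ' (map encode xs))

  X : Subst → List V → V
  X σ xs = X' (concatMap (λ y → fv (σ y)) xs)

  infixl 6 _•_
  _•_ : Λ → Subst → Λ
  c k • σ = c k
  v x • σ = σ x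
  (M · N) • σ = (M • σ) · (N • σ)
  (ƛ[ x ∶ A ] M) • σ =
    let y = X σ (fv M - x) in ƛ[ y ∶ A • σ ] (M • (σ , x := v y))
  (Π[ x ∶ A ] B) • σ =
    let y = X σ (fv B - x) in Π[ y ∶ A • σ ] (B • (σ , x := v y))

  _[_:=_] : Λ → V → Λ → Λ
  M [ x := N ] = M • (ι , x := N)

  data _∼α_ : Λ → Λ → Set where
    α-c   : ∀ {k} → c k ∼α c k
    α-v   : ∀ {x} → v x ∼α v x
    α-app : ∀ {M M' N N'} → M ∼α M' → N ∼α N' → (M · N) ∼α (M' · N')
    α-ƛ   : ∀ {x x' A A' M M'} (y : V) → A ∼α A' →
            y ∉ (fv M - x) → y ∉ (fv M' - x') →
            M [ x := v y ] ≡ M' [ x' := v y ] →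
            (ƛ[ x ∶ A ] M) ∼α (ƛ[ x' ∶ A' ] M')
    α-Π   : ∀ {x x' A A' M M'} (y : V) → A ∼α A' →
            y ∉ (fv M - x) → y ∉ (fv M' - x') →
            M [ x := v y ] ≡ M' [ x' := v y ] →
            (Π[ x ∶ A ] M) ∼α (Π[ x' ∶ A' ] M')

  data Ctx (S : Rel Λ 0ℓ) : Rel Λ 0ℓ where
    base  : ∀ {M N} → S M N → Ctx S M N
    ƛ-body : ∀ {x A M M'} → Ctx S M M' → Ctx S (ƛ[ x ∶ A ] M) (ƛ[ x ∶ A ] M')
    ƛ-ann  : ∀ {x A A' M} → Ctx S A A' → Ctx S (ƛ[ x ∶ A ] M) (ƛ[ x ∶ A' ] M)
    Π-cod  : ∀ {x A B B'} → Ctx S B B' → Ctx S (Π[ x ∶ A ] B) (Π[ x ∶ A ] B')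
    Π-dom  : ∀ {x A A' B} → Ctx S A A' → Ctx S (Π[ x ∶ A ] B) (Π[ x ∶ A' ] B)
    app-l  : ∀ {M M' N} → Ctx S M M' → Ctx S (M · N) (M' · N)
    app-r  : ∀ {M N N'} → Ctx S N N' → Ctx S (M · N) (M · N')

  data β-redex : Rel Λ 0ℓ where
    β : ∀ {x A M N} → β-redex ((ƛ[ x ∶ A ] M) · N) (M [ x := N ])

  _→β_ : Rel Λ 0ℓ
  _→β_ = Ctx β-redex

  _≃β_ : Rel Λ 0ℓ
  _≃β_ = EqClosure (_∼α_ ∪ _→β_)

  Context : Set
  Context = List (V × Λ)

  _,,_∶_ : Context → V → Λ → Context
  Γ ,, x ∶ A = (x , A) ∷ Γ

  dom : Context → List V
  dom Γ = map proj₁ Γ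

  data _ok : Context → Set
  data _⊢_∶_ : Context → Λ → Λ → Set

  data _ok where
    nil  : [] ok
    cons : ∀ {Γ x A s} → Γ ok → Γ ⊢ A ∶ c s → x ∉ dom Γ → (Γ ,, x ∶ A) ok

  data _⊢_∶_ where
    sort : ∀ {Γ s₁ s₂} → Γ ok → 𝒜 s₁ s₂ → Γ ⊢ c s₁ ∶ c s₂
    prod : ∀ {Γ x A B s₁ s₂ s₃} → Γ ⊢ A ∶ c s₁ →
           (∀ y → y ∉ dom Γ → (Γ ,, y ∶ A) ⊢ B [ x := v y ] ∶ c s₂) →
           ℛ s₁ s₂ s₃ → Γ ⊢ Π[ x ∶ A ] B ∶ c s₃
    var  : ∀ {Γ x A} → Γ ok → (x , A) ∈ Γ → Γ ⊢ v x ∶ A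
    abs  : ∀ {Γ x y A B M s₁ s₂ s₃} → Γ ⊢ A ∶ c s₁ →
           (∀ z → z ∉ dom Γ → (Γ ,, z ∶ A) ⊢ B [ y := v z ] ∶ c s₂) →
           (∀ z → z ∉ dom Γ → (Γ ,, z ∶ A) ⊢ M [ x := v z ] ∶ B [ y := v z ]) →
           ℛ s₁ s₂ s₃ → Γ ⊢ ƛ[ x ∶ A ] M ∶ Π[ y ∶ A ] B
    app  : ∀ {Γ M N x A B s} → Γ ⊢ M ∶ Π[ x ∶ A ] B → Γ ⊢ N ∶ A →
           Γ ⊢ B [ x := N ] ∶ c s → Γ ⊢ M · N ∶ B [ x := N ]
    conv : ∀ {Γ M A B s} → Γ ⊢ M ∶ A → A ≃β B → Γ ⊢ B ∶ c s → Γ ⊢ M ∶ B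

  _∶_⇀_ : Subst → Context → Context → Set
  σ ∶ Γ ⇀ Δ = ∀ {x A} → (x , A) ∈ Γ → Δ ⊢ σ x ∶ A • σ

-- Substitution • renames every bound variable to a name X chosen from the free variables of the substituted
-- terms. Composition M • σ • τ ≡ M • (σ ⊙ τ) holds on the nose, but laws that change the binding structure, such
-- as commuting [ x := N ] with σ, hold only up to the choice of bound names. Write P ≈ Q for P • ι ≡ Q • ι, where
-- ι renames all binders canonically: these laws hold up to ≈, every α-conversion gives ≈, and P ∼α P • ι makes ≈
-- imply ≃β. Hence β-steps and conversion are stable under substitution, and typing is invariant under ≈ of the
-- subject. The lemma follows by induction on the derivation: a premise under a binder is used at a variable fresh
-- for Γ and the term, pushed through the extended substitution, and transported along ≈ to the bound name chosen
-- by •.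

module Submission where

open import Defs
open import Data.Nat using (ℕ)
open import Data.List using (List; []; _∷_; _++_; map; concat; concatMap)
open import Data.List.Properties using (++-identityʳ; concatMap-++; concatMap-cong; concatMap-pure; map-cong-local)
open import Data.List.Effectful using (module MonadProperties)
open import Data.List.Membership.Propositional using (_∈_; _∉_; lose; find)
open import Data.List.Membership.Propositional.Properties using (∈-++⁺ˡ; ∈-++⁺ʳ; ∈-map⁺; ∈-concatMap⁺; ∈-concatMap⁻)
open import Data.List.Relation.Binary.Subset.Propositional using (_⊆_)
open import Data.List.Relation.Binary.Subset.Propositional.Properties
  using (map⁺; concatMap⁺; xs⊆ys++xs; ++⁺ˡ; ++⁺ʳ; ∷⁺ʳ)
open import Data.List.Relation.Unary.All using (tabulate)
open import Data.List.Relation.Unary.Any using (here; there)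
open import Data.Product using (∃; _×_; _,_; proj₁; proj₂)
open import Data.Sum using (inj₁; inj₂)
open import Data.Empty using (⊥-elim)
open import Relation.Nullary using (yes; no)
open import Relation.Binary using (DecidableEquality; IsEquivalence)
open import Relation.Binary.PropositionalEquality
open import Relation.Binary.Construct.Closure.ReflexiveTransitive using (ε; _◅_)
open import Relation.Binary.Construct.Closure.Symmetric using (fwd; bwd)
open import Relation.Binary.Construct.Union using (_∪_)
import Relation.Binary.Construct.Closure.Equivalence as EqClosure

module _ {A B : Set} (f : A → List B) where

  ∈-concatMap⁺′ : ∀ {a as b} → a ∈ as → b ∈ f a → b ∈ concatMap f as
  ∈-concatMap⁺′ a∈as b∈fa = ∈-concatMap⁺ f (lose a∈as b∈fa)

  ∈-concatMap⁻′ : ∀ as {b} → b ∈ concatMap f as → ∃ λ a → a ∈ as × b ∈ f a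
  ∈-concatMap⁻′ as b∈ = find (∈-concatMap⁻ f {xs = as} b∈)

  concatMap-cong-∈ : ∀ {g} as → (∀ {a} → a ∈ as → f a ≡ g a) → concatMap f as ≡ concatMap g as
  concatMap-cong-∈ as f≡g = cong concat (map-cong-local (tabulate f≡g))

module Substitution
  (V : Set) (_≟_ : DecidableEquality V)
  (encode : V → ℕ) (decode : ℕ → V)
  (encode-decode : ∀ n → encode (decode n) ≡ n)
  (C : Set)
  (χ' : List ℕ → ℕ) (χ'-fresh : ∀ ns → χ' ns ∉ ns)
  (𝒜 : C → C → Set) (ℛ : C → C → C → Set) where

  open PTS V _≟_ encode decode encode-decode C χ' χ'-fresh 𝒜 ℛ

  X'-∉ : ∀ xs → X' xs ∉ xs
  X'-∉ xs x∈xs =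
    χ'-fresh (map encode xs) (subst (_∈ map encode xs) (encode-decode _) (∈-map⁺ encode x∈xs))

  X'-∉-⊆ : ∀ {xs ys} → ys ⊆ xs → X' xs ∉ ys
  X'-∉-⊆ ys⊆xs x∈ys = X'-∉ _ (ys⊆xs x∈ys)

  ∈-remove⁻ : ∀ xs {x u} → u ∈ xs - x → u ∈ xs × u ≢ x
  ∈-remove⁻ [] ()
  ∈-remove⁻ (y ∷ ys) {x} u∈ with y ≟ x
  ∈-remove⁻ (y ∷ ys) u∈ | yes _ = let u∈ys , u≢x = ∈-remove⁻ ys u∈ in there u∈ys , u≢x
  ∈-remove⁻ (y ∷ ys) (here refl) | no y≢x = here refl , y≢x
  ∈-remove⁻ (y ∷ ys) (there u∈) | no _ = let u∈ys , u≢x = ∈-remove⁻ ys u∈ in there u∈ys , u≢x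

  ∈-remove⁺ : ∀ xs {x u} → u ∈ xs → u ≢ x → u ∈ xs - x
  ∈-remove⁺ (y ∷ ys) {x} u∈ u≢x with y ≟ x
  ∈-remove⁺ (y ∷ ys) (here refl) u≢x | yes y≡x = ⊥-elim (u≢x y≡x)
  ∈-remove⁺ (y ∷ ys) (there u∈) u≢x | yes _ = ∈-remove⁺ ys u∈ u≢x
  ∈-remove⁺ (y ∷ ys) (here refl) u≢x | no _ = here refl
  ∈-remove⁺ (y ∷ ys) (there u∈) u≢x | no _ = there (∈-remove⁺ ys u∈ u≢x)

  remove⁺ : ∀ {xs ys} x → xs ⊆ ys → xs - x ⊆ ys - x
  remove⁺ {xs} {ys} x xs⊆ys u∈ = let u∈xs , u≢x = ∈-remove⁻ xs u∈ in ∈-remove⁺ ys (xs⊆ys u∈xs) u≢x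

  remove-++ : ∀ xs ys x → (xs ++ ys) - x ≡ (xs - x) ++ (ys - x)
  remove-++ [] ys x = refl
  remove-++ (y ∷ xs) ys x with y ≟ x
  ... | yes _ = remove-++ xs ys x
  ... | no _ = cong (y ∷_) (remove-++ xs ys x)

  remove-∉ : ∀ xs {x} → x ∉ xs → xs - x ≡ xs
  remove-∉ [] x∉ = refl
  remove-∉ (y ∷ xs) {x} x∉ with y ≟ x
  ... | yes y≡x = ⊥-elim (x∉ (here (sym y≡x)))
  ... | no _ = cong (y ∷_) (remove-∉ xs (λ x∈ → x∉ (there x∈)))

  remove-head : ∀ y ys → (y ∷ ys) - y ≡ ys - y
  remove-head y ys with y ≟ y
  ... | yes _ = refl
  ... | no y≢y = ⊥-elim (y≢y refl)

  -- Substitution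

  fvs : Subst → List V → List V
  fvs σ = concatMap (λ w → fv (σ w))

  fresh : Subst → V → Λ → V
  fresh σ x M = X σ (fv M - x)

  -- (ƛ[ x ∶ A ] M) • σ  is  ƛ[ fresh σ x M ∶ A • σ ] (M • under σ x M)  by definition.
  under : Subst → V → Λ → Subst
  under σ x M = σ , x := v (fresh σ x M)

  infixl 5 _⊙_
  _⊙_ : Subst → Subst → Subst
  (σ ⊙ τ) w = σ w • τ

  infix 4 _≗[_]_
  _≗[_]_ : Subst → List V → Subst → Set
  σ ≗[ xs ] τ = ∀ {w} → w ∈ xs → σ w ≡ τ w

  extend-≡ : ∀ σ x N → (σ , x := N) x ≡ N
  extend-≡ σ x N with x ≟ x
  ... | yes _ = refl
  ... | no x≢x = ⊥-elim (x≢x refl)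

  extend-≢ : ∀ σ x N {w} → w ≢ x → (σ , x := N) w ≡ σ w
  extend-≢ σ x N {w} w≢x with w ≟ x
  ... | yes w≡x = ⊥-elim (w≢x w≡x)
  ... | no _ = refl

  extend-cong : ∀ {σ τ} xs x N → σ ≗[ xs - x ] τ → (σ , x := N) ≗[ xs ] (τ , x := N)
  extend-cong xs x N σ≗τ {w} w∈ with w ≟ x
  ... | yes _ = refl
  ... | no w≢x = σ≗τ (∈-remove⁺ xs w∈ w≢x)

  ƛ-cong : ∀ {y y' A A' M M'} → y ≡ y' → A ≡ A' → M ≡ M' → ƛ[ y ∶ A ] M ≡ ƛ[ y' ∶ A' ] M'
  ƛ-cong refl refl refl = refl

  Π-cong : ∀ {y y' A A' M M'} → y ≡ y' → A ≡ A' → M ≡ M' → Π[ y ∶ A ] M ≡ Π[ y' ∶ A' ] M'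
  Π-cong refl refl refl = refl

  ƛ-injective : ∀ {y y' A A' M M'} → ƛ[ y ∶ A ] M ≡ ƛ[ y' ∶ A' ] M' → y ≡ y' × A ≡ A' × M ≡ M'
  ƛ-injective refl = refl , refl , refl

  Π-injective : ∀ {y y' A A' M M'} → Π[ y ∶ A ] M ≡ Π[ y' ∶ A' ] M' → y ≡ y' × A ≡ A' × M ≡ M'
  Π-injective refl = refl , refl , refl

  ·-injective : ∀ {M M' N N'} → M · N ≡ M' · N' → M ≡ M' × N ≡ N'
  ·-injective refl = refl , refl

  fresh-cong : ∀ x M {σ τ} → σ ≗[ fv M - x ] τ → fresh σ x M ≡ fresh τ x M
  fresh-cong x M σ≗τ = cong X' (concatMap-cong-∈ _ (fv M - x) (λ w∈ → cong fv (σ≗τ w∈)))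

  mutual
    •-cong : ∀ M {σ τ} → σ ≗[ fv M ] τ → M • σ ≡ M • τ
    •-cong (c k) σ≗τ = refl
    •-cong (v x) σ≗τ = σ≗τ (here refl)
    •-cong (M · N) σ≗τ =
      cong₂ _·_ (•-cong M (λ w∈ → σ≗τ (∈-++⁺ˡ w∈))) (•-cong N (λ w∈ → σ≗τ (∈-++⁺ʳ (fv M) w∈)))
    •-cong (ƛ[ x ∶ A ] M) σ≗τ =
      ƛ-cong (fresh-cong x M (λ w∈ → σ≗τ (∈-++⁺ʳ (fv A) w∈))) (•-cong A (λ w∈ → σ≗τ (∈-++⁺ˡ w∈)))
             (•-cong-under x M (λ w∈ → σ≗τ (∈-++⁺ʳ (fv A) w∈)))
    •-cong (Π[ x ∶ A ] B) σ≗τ =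
      Π-cong (fresh-cong x B (λ w∈ → σ≗τ (∈-++⁺ʳ (fv A) w∈))) (•-cong A (λ w∈ → σ≗τ (∈-++⁺ˡ w∈)))
             (•-cong-under x B (λ w∈ → σ≗τ (∈-++⁺ʳ (fv A) w∈)))

    •-cong-under : ∀ x M {σ τ} → σ ≗[ fv M - x ] τ → M • under σ x M ≡ M • under τ x M
    •-cong-under x M {σ} {τ} σ≗τ =
      trans (•-cong M (extend-cong (fv M) x _ σ≗τ)) (cong (λ y → M • (τ , x := v y)) (fresh-cong x M σ≗τ))

  •-extend-∉ : ∀ M σ y N → y ∉ fv M → M • (σ , y := N) ≡ M • σ
  •-extend-∉ M σ y N y∉ = •-cong M (λ w∈ → extend-≢ σ y N (λ { refl → y∉ w∈ }))

  fvs-extend : ∀ σ x y ws → y ∉ fvs σ (ws - x) → fvs (σ , x := v y) ws - y ≡ fvs σ (ws - x)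
  fvs-extend σ x y [] y∉ = refl
  fvs-extend σ x y (w ∷ ws) y∉ with w ≟ x
  ... | yes _ = trans (remove-head y _) (fvs-extend σ x y ws y∉)
  ... | no _ =
    trans (remove-++ (fv (σ w)) _ y)
          (cong₂ _++_ (remove-∉ (fv (σ w)) (λ y∈ → y∉ (∈-++⁺ˡ y∈)))
                      (fvs-extend σ x y ws (λ y∈ → y∉ (∈-++⁺ʳ (fv (σ w)) y∈))))

  mutual
    fv-• : ∀ M σ → fv (M • σ) ≡ fvs σ (fv M)
    fv-• (c k) σ = refl
    fv-• (v x) σ = sym (++-identityʳ _)
    fv-• (M · N) σ = trans (cong₂ _++_ (fv-• M σ) (fv-• N σ)) (sym (concatMap-++ _ (fv M) (fv N)))
    fv-• (ƛ[ x ∶ A ] M) σ =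
      trans (cong₂ _++_ (fv-• A σ) (fv-•-binder M σ x _ (X'-∉ _))) (sym (concatMap-++ _ (fv A) (fv M - x)))
    fv-• (Π[ x ∶ A ] B) σ =
      trans (cong₂ _++_ (fv-• A σ) (fv-•-binder B σ x _ (X'-∉ _))) (sym (concatMap-++ _ (fv A) (fv B - x)))

    fv-•-binder : ∀ M σ x y → y ∉ fvs σ (fv M - x) → fv (M • (σ , x := v y)) - y ≡ fvs σ (fv M - x)
    fv-•-binder M σ x y y∉ = trans (cong (_- y) (fv-• M _)) (fvs-extend σ x y (fv M) y∉)

  fvs-⊙ : ∀ σ τ ws → fvs τ (fvs σ ws) ≡ fvs (σ ⊙ τ) ws
  fvs-⊙ σ τ ws =
    trans (sym (MonadProperties.associative ws (λ w → fv (σ w)) (λ u → fv (τ u))))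
          (concatMap-cong (λ w → sym (fv-• (σ w) τ)) ws)

  fresh-⊙ : ∀ σ τ x M → fresh τ (fresh σ x M) (M • under σ x M) ≡ fresh (σ ⊙ τ) x M
  fresh-⊙ σ τ x M = cong X' (trans (cong (fvs τ) (fv-•-binder M σ x _ (X'-∉ _))) (fvs-⊙ σ τ (fv M - x)))

  ⊙-extend : ∀ σ τ x y N ws → y ∉ fvs σ (ws - x) → (σ , x := v y) ⊙ (τ , y := N) ≗[ ws ] (σ ⊙ τ) , x := N
  ⊙-extend σ τ x y N ws y∉ {w} w∈ with w ≟ x
  ... | yes _ = extend-≡ τ y N
  ... | no w≢x = •-extend-∉ (σ w) τ y N (λ y∈ → y∉ (∈-concatMap⁺′ _ (∈-remove⁺ ws w∈ w≢x) y∈))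

  mutual
    •-• : ∀ M σ τ → M • σ • τ ≡ M • (σ ⊙ τ)
    •-• (c k) σ τ = refl
    •-• (v x) σ τ = refl
    •-• (M · N) σ τ = cong₂ _·_ (•-• M σ τ) (•-• N σ τ)
    •-• (ƛ[ x ∶ A ] M) σ τ = ƛ-cong (fresh-⊙ σ τ x M) (•-• A σ τ) (•-•-under σ τ x M)
    •-• (Π[ x ∶ A ] B) σ τ = Π-cong (fresh-⊙ σ τ x B) (•-• A σ τ) (•-•-under σ τ x B)

    •-•-under : ∀ σ τ x M →
                M • under σ x M • under τ (fresh σ x M) (M • under σ x M) ≡ M • under (σ ⊙ τ) x M
    •-•-under σ τ x M =
      trans (•-• M _ _)
            (trans (•-cong M (⊙-extend σ τ x _ _ (fv M) (X'-∉ _)))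
                   (cong (λ y → M • ((σ ⊙ τ) , x := v y)) (fresh-⊙ σ τ x M)))

  •-⊙-extend : ∀ M σ τ x y N → y ∉ fvs σ (fv M - x) → M • (σ , x := v y) • (τ , y := N) ≡ M • ((σ ⊙ τ) , x := N)
  •-⊙-extend M σ τ x y N y∉ = trans (•-• M _ _) (•-cong M (⊙-extend σ τ x y N (fv M) y∉))

  -- Canonical α-equivalence

  infix 4 _≈_
  record _≈_ (P Q : Λ) : Set where
    constructor canonical
    field •ι-≡ : P • ι ≡ Q • ι

  ≈-refl : ∀ {P} → P ≈ P
  ≈-refl = canonical refl

  ≈-sym : ∀ {P Q} → P ≈ Q → Q ≈ P
  ≈-sym (canonical P≡Q) = canonical (sym P≡Q)

  ≈-trans : ∀ {P Q R} → P ≈ Q → Q ≈ R → P ≈ R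
  ≈-trans (canonical P≡Q) (canonical Q≡R) = canonical (trans P≡Q Q≡R)

  ≡⇒≈ : ∀ {P Q} → P ≡ Q → P ≈ Q
  ≡⇒≈ P≡Q = canonical (cong (_• ι) P≡Q)

  ι-• : ∀ P σ → P • ι • σ ≡ P • σ
  ι-• P σ = trans (•-• P ι σ) (•-cong P (λ _ → refl))

  ≈-ι : ∀ P → P • ι ≈ P
  ≈-ι P = canonical (ι-• P ι)

  ≈-• : ∀ {P Q} σ → P ≈ Q → P • σ ≡ Q • σ
  ≈-• {P} {Q} σ (canonical P≡Q) = trans (sym (ι-• P σ)) (trans (cong (_• σ) P≡Q) (ι-• Q σ))

  •-cong-≈ : ∀ M {σ τ} → (∀ {w} → w ∈ fv M → σ w ≈ τ w) → M • σ ≈ M • τ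
  •-cong-≈ M {σ} {τ} σ≈τ =
    canonical (trans (•-• M σ ι) (trans (•-cong M (λ w∈ → _≈_.•ι-≡ (σ≈τ w∈))) (sym (•-• M τ ι))))

  fvs-ι : ∀ ws → fvs ι ws ≡ ws
  fvs-ι = concatMap-pure

  fv-≈ : ∀ {P Q} → P ≈ Q → fv P ≡ fv Q
  fv-≈ {P} {Q} (canonical P≡Q) = begin
    fv P          ≡⟨ sym (fvs-ι (fv P)) ⟩
    fvs ι (fv P)  ≡⟨ sym (fv-• P ι) ⟩
    fv (P • ι)    ≡⟨ cong fv P≡Q ⟩
    fv (Q • ι)    ≡⟨ fv-• Q ι ⟩
    fvs ι (fv Q)  ≡⟨ fvs-ι (fv Q) ⟩
    fv Q          ∎
    where open ≡-Reasoning

  ∉-fvs-ι : ∀ {y ws} → y ∉ ws → y ∉ fvs ι ws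
  ∉-fvs-ι {y} {ws} = subst (y ∉_) (sym (fvs-ι ws))

  fresh-ι-∉ : ∀ x M → fresh ι x M ∉ fv M - x
  fresh-ι-∉ x M = subst (fresh ι x M ∉_) (fvs-ι _) (X'-∉ _)

  rename-• : ∀ M x y σ N → y ∉ fv M - x → M [ x := v y ] • (σ , y := N) ≡ M • (σ , x := N)
  rename-• M x y σ N y∉ = •-⊙-extend M ι σ x y N (∉-fvs-ι y∉)

  fv-rename : ∀ M x y → y ∉ fv M - x → fv (M [ x := v y ]) - y ≡ fv M - x
  fv-rename M x y y∉ = trans (fv-•-binder M ι x y (∉-fvs-ι y∉)) (fvs-ι _)

  ∉-rename : ∀ M x y → y ∉ fv M - x → y ∉ fv (M [ x := v y ]) - y
  ∉-rename M x y y∉ = subst (y ∉_) (sym (fv-rename M x y y∉)) y∉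

  infix 4 [_]_≈ᵇ[_]_
  record [_]_≈ᵇ[_]_ (x : V) (M : Λ) (x' : V) (M' : Λ) : Set where
    constructor _,_
    field
      fresh-≡ : fresh ι x M ≡ fresh ι x' M'
      body-≡ : M • under ι x M ≡ M' • under ι x' M'

  ƛ-≈ : ∀ {x x' A A' M M'} → A ≈ A' → [ x ] M ≈ᵇ[ x' ] M' → ƛ[ x ∶ A ] M ≈ ƛ[ x' ∶ A' ] M'
  ƛ-≈ (canonical A≡A') (fresh≡ , body≡) = canonical (ƛ-cong fresh≡ A≡A' body≡)

  Π-≈ : ∀ {x x' A A' B B'} → A ≈ A' → [ x ] B ≈ᵇ[ x' ] B' → Π[ x ∶ A ] B ≈ Π[ x' ∶ A' ] B'
  Π-≈ (canonical A≡A') (fresh≡ , body≡) = canonical (Π-cong fresh≡ A≡A' body≡)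

  ·-≈ : ∀ {M M' N N'} → M ≈ M' → N ≈ N' → M · N ≈ M' · N'
  ·-≈ (canonical M≡M') (canonical N≡N') = canonical (cong₂ _·_ M≡M' N≡N')

  ƛ-≈⁻ : ∀ {x x' A A' M M'} → ƛ[ x ∶ A ] M ≈ ƛ[ x' ∶ A' ] M' → A ≈ A' × [ x ] M ≈ᵇ[ x' ] M'
  ƛ-≈⁻ (canonical P≡Q) = let fresh≡ , A≡A' , body≡ = ƛ-injective P≡Q in canonical A≡A' , (fresh≡ , body≡)

  Π-≈⁻ : ∀ {x x' A A' B B'} → Π[ x ∶ A ] B ≈ Π[ x' ∶ A' ] B' → A ≈ A' × [ x ] B ≈ᵇ[ x' ] B'
  Π-≈⁻ (canonical P≡Q) = let fresh≡ , A≡A' , body≡ = Π-injective P≡Q in canonical A≡A' , (fresh≡ , body≡)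

  ·-≈⁻ : ∀ {M M' N N'} → M · N ≈ M' · N' → M ≈ M' × N ≈ N'
  ·-≈⁻ (canonical P≡Q) = let M≡M' , N≡N' = ·-injective P≡Q in canonical M≡M' , canonical N≡N'

  ≈ᵇ-intro : ∀ {x x' M M'} z → z ∉ fv M - x → z ∉ fv M' - x' → M [ x := v z ] ≈ M' [ x' := v z ] →
             [ x ] M ≈ᵇ[ x' ] M'
  ≈ᵇ-intro {x} {x'} {M} {M'} z z∉M z∉M' M≈M' = fresh≡ , body≡
    where
      open ≡-Reasoning
      fresh≡ : fresh ι x M ≡ fresh ι x' M'
      fresh≡ = cong (X ι) (begin
        fv M - x                   ≡⟨ sym (fv-rename M x z z∉M) ⟩
        fv (M [ x := v z ]) - z    ≡⟨ cong (_- z) (fv-≈ M≈M') ⟩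
        fv (M' [ x' := v z ]) - z  ≡⟨ fv-rename M' x' z z∉M' ⟩
        fv M' - x'                 ∎)
      body≡ : M • under ι x M ≡ M' • under ι x' M'
      body≡ = begin
        M • under ι x M                                  ≡⟨ sym (rename-• M x z ι _ z∉M) ⟩
        M [ x := v z ] • (ι , z := v (fresh ι x M))      ≡⟨ ≈-• _ M≈M' ⟩
        M' [ x' := v z ] • (ι , z := v (fresh ι x M))    ≡⟨ rename-• M' x' z ι _ z∉M' ⟩
        M' • (ι , x' := v (fresh ι x M))                 ≡⟨ cong (λ y → M' • (ι , x' := v y)) fresh≡ ⟩
        M' • under ι x' M'                               ∎

  ≈ᵇ-[:=] : ∀ {x x' M M'} → [ x ] M ≈ᵇ[ x' ] M' → ∀ y → M [ x := v y ] ≡ M' [ x' := v y ]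
  ≈ᵇ-[:=] {x} {x'} {M} {M'} (fresh≡ , body≡) y = begin
    M [ x := v y ]                                      ≡⟨ sym (rename-• M x _ ι (v y) (fresh-ι-∉ x M)) ⟩
    M • under ι x M • (ι , fresh ι x M := v y)          ≡⟨ cong₂ (λ P z → P • (ι , z := v y)) body≡ fresh≡ ⟩
    M' • under ι x' M' • (ι , fresh ι x' M' := v y)     ≡⟨ rename-• M' x' _ ι (v y) (fresh-ι-∉ x' M') ⟩
    M' [ x' := v y ]                                    ∎
    where open ≡-Reasoning

  ≈ᵇ-under : ∀ M σ x {y C} → C ≈ M • (σ , x := v y) → y ∉ fvs σ (fv M - x) →
             [ y ] C ≈ᵇ[ fresh σ x M ] M • under σ x M
  ≈ᵇ-under M σ x {y} {C} C≈ y∉ = ≈ᵇ-intro y' y'∉C y'∉M (≡⇒≈ (begin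
      C [ y := v y' ]                              ≡⟨ ≈-• _ C≈ ⟩
      M • (σ , x := v y) • (ι , y := v y')         ≡⟨ •-⊙-extend M σ ι x y _ y∉ ⟩
      M • ((σ ⊙ ι) , x := v y')                    ≡⟨ sym (•-⊙-extend M σ ι x y' _ (X'-∉ _)) ⟩
      M • under σ x M • (ι , y' := v y')           ∎))
    where
      open ≡-Reasoning
      y' = fresh σ x M
      y'∉C : y' ∉ fv C - y
      y'∉C = subst (y' ∉_) (sym (trans (cong (_- y) (fv-≈ C≈)) (fv-•-binder M σ x y y∉))) (X'-∉ _)
      y'∉M : y' ∉ fv (M • under σ x M) - y'
      y'∉M = subst (y' ∉_) (sym (fv-•-binder M σ x y' (X'-∉ _))) (X'-∉ _)

  α⇒≈ : ∀ {P Q} → P ∼α Q → P ≈ Q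
  α⇒≈ α-c = ≈-refl
  α⇒≈ α-v = ≈-refl
  α⇒≈ (α-app M∼M' N∼N') = ·-≈ (α⇒≈ M∼M') (α⇒≈ N∼N')
  α⇒≈ (α-ƛ y A∼A' y∉M y∉M' M≡M') = ƛ-≈ (α⇒≈ A∼A') (≈ᵇ-intro y y∉M y∉M' (≡⇒≈ M≡M'))
  α⇒≈ (α-Π y A∼A' y∉B y∉B' B≡B') = Π-≈ (α⇒≈ A∼A') (≈ᵇ-intro y y∉B y∉B' (≡⇒≈ B≡B'))

  ∼α-ι : ∀ P → P ∼α P • ι
  ∼α-ι (c k) = α-c
  ∼α-ι (v x) = α-v
  ∼α-ι (M · N) = α-app (∼α-ι M) (∼α-ι N)
  ∼α-ι (ƛ[ x ∶ A ] M) =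
    α-ƛ _ (∼α-ι A) (fresh-ι-∉ x M) (∉-rename M x _ (fresh-ι-∉ x M)) (sym (rename-• M x _ ι _ (fresh-ι-∉ x M)))
  ∼α-ι (Π[ x ∶ A ] B) =
    α-Π _ (∼α-ι A) (fresh-ι-∉ x B) (∉-rename B x _ (fresh-ι-∉ x B)) (sym (rename-• B x _ ι _ (fresh-ι-∉ x B)))

  ≈⇒≃β : ∀ {P Q} → P ≈ Q → P ≃β Q
  ≈⇒≃β {P} {Q} (canonical P≡Q) = fwd (inj₁ (∼α-ι P)) ◅ subst (_≃β Q) (sym P≡Q) (bwd (inj₁ (∼α-ι Q)) ◅ ε)

  -- β-reduction and substitution

  [:=]-• : ∀ M x N σ → M [ x := N ] • σ ≡ M • (σ , x := (N • σ))
  [:=]-• M x N σ = trans (•-• M _ σ) (•-cong M (λ {w} _ → extend-⊙ w))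
    where
      extend-⊙ : ∀ w → ((ι , x := N) ⊙ σ) w ≡ (σ , x := (N • σ)) w
      extend-⊙ w with w ≟ x
      ... | yes _ = refl
      ... | no _ = refl

  under-[:=] : ∀ M x σ N → (M • under σ x M) [ fresh σ x M := N ] ≈ M • (σ , x := N)
  under-[:=] M x σ N = ≈-trans (≡⇒≈ (•-⊙-extend M σ ι x _ N (X'-∉ _))) (•-cong-≈ M (λ {w} _ → ⊙ι-≈ w))
    where
      ⊙ι-≈ : ∀ w → ((σ ⊙ ι) , x := N) w ≈ (σ , x := N) w
      ⊙ι-≈ w with w ≟ x
      ... | yes _ = ≈-refl
      ... | no _ = ≈-ι (σ w)

  [:=]-•-≈ : ∀ M x N σ → M [ x := N ] • σ ≈ (M • under σ x M) [ fresh σ x M := N • σ ]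
  [:=]-•-≈ M x N σ = ≈-trans (≡⇒≈ ([:=]-• M x N σ)) (≈-sym (under-[:=] M x σ (N • σ)))

  rename-•-≈ : ∀ M x y σ z → y ∉ fv M - x →
               M [ x := v y ] • (σ , y := v z) ≈ (M • under σ x M) [ fresh σ x M := v z ]
  rename-•-≈ M x y σ z y∉ = ≈-trans (≡⇒≈ (rename-• M x y σ (v z) y∉)) (≈-sym (under-[:=] M x σ (v z)))

  fv-[:=]-⊆ : ∀ M x N → fv (M [ x := N ]) ⊆ (fv M - x) ++ fv N
  fv-[:=]-⊆ M x N u∈ with ∈-concatMap⁻′ _ (fv M) (subst (_ ∈_) (fv-• M _) u∈)
  ... | w , w∈ , u∈w with w ≟ x
  ...   | yes _ = ∈-++⁺ʳ _ u∈w
  ...   | no w≢x with u∈w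
  ...     | here refl = ∈-++⁺ˡ (∈-remove⁺ (fv M) w∈ w≢x)

  →β-fv : ∀ {P Q} → P →β Q → fv Q ⊆ fv P
  →β-fv (base (β {x} {A} {M} {N})) u∈ = ++⁺ˡ (fv N) (xs⊆ys++xs (fv M - x) (fv A)) (fv-[:=]-⊆ M x N u∈)
  →β-fv (ƛ-body {x} {A} s) = ++⁺ʳ (fv A) (remove⁺ x (→β-fv s))
  →β-fv (ƛ-ann {x} {M = M} s) = ++⁺ˡ (fv M - x) (→β-fv s)
  →β-fv (Π-cod {x} {A} s) = ++⁺ʳ (fv A) (remove⁺ x (→β-fv s))
  →β-fv (Π-dom {x} {B = B} s) = ++⁺ˡ (fv B - x) (→β-fv s)
  →β-fv (app-l {N = N} s) = ++⁺ˡ (fv N) (→β-fv s)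
  →β-fv (app-r {M} s) = ++⁺ʳ (fv M) (→β-fv s)

  →β-• : ∀ {P Q} → P →β Q → ∀ σ → ∃ λ R → (P • σ) →β R × R ≈ Q • σ
  →β-• (base (β {x} {M = M} {N})) σ = _ , base β , ≈-sym ([:=]-•-≈ M x N σ)
  →β-• (ƛ-body {x} {M = M} {M'} s) σ =
    let R , s' , R≈ = →β-• s (under σ x M) in
    _ , ƛ-body s' , ƛ-≈ ≈-refl (≈ᵇ-under M' σ x R≈ (X'-∉-⊆ (concatMap⁺ _ (remove⁺ x (→β-fv s)))))
  →β-• (Π-cod {x} {B = B} {B'} s) σ =
    let R , s' , R≈ = →β-• s (under σ x B) in
    _ , Π-cod s' , Π-≈ ≈-refl (≈ᵇ-under B' σ x R≈ (X'-∉-⊆ (concatMap⁺ _ (remove⁺ x (→β-fv s)))))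
  →β-• (ƛ-ann s) σ = let R , s' , R≈ = →β-• s σ in _ , ƛ-ann s' , ƛ-≈ R≈ (refl , refl)
  →β-• (Π-dom s) σ = let R , s' , R≈ = →β-• s σ in _ , Π-dom s' , Π-≈ R≈ (refl , refl)
  →β-• (app-l s) σ = let R , s' , R≈ = →β-• s σ in _ , app-l s' , ·-≈ R≈ ≈-refl
  →β-• (app-r s) σ = let R , s' , R≈ = →β-• s σ in _ , app-r s' , ·-≈ ≈-refl R≈

  ≃β-• : ∀ σ {P Q} → P ≃β Q → P • σ ≃β Q • σ
  ≃β-• σ = EqClosure.gfold (EqClosure.isEquivalence _) (_• σ) step
    where
      step : ∀ {P Q} → (_∼α_ ∪ _→β_) P Q → P • σ ≃β Q • σ
      step (inj₁ P∼Q) = IsEquivalence.reflexive (EqClosure.isEquivalence _) (≈-• σ (α⇒≈ P∼Q))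
      step (inj₂ P→Q) = let R , P→R , R≈ = →β-• P→Q σ in fwd (inj₂ P→R) ◅ ≈⇒≃β R≈

  -- Typing

  ⊢-ok : ∀ {Γ M A} → Γ ⊢ M ∶ A → Γ ok
  ⊢-ok (sort Γok _) = Γok
  ⊢-ok (prod ⊢A _ _) = ⊢-ok ⊢A
  ⊢-ok (var Γok _) = Γok
  ⊢-ok (abs ⊢A _ _ _) = ⊢-ok ⊢A
  ⊢-ok (app ⊢M _ _) = ⊢-ok ⊢M
  ⊢-ok (conv ⊢M _ _) = ⊢-ok ⊢M

  ∈-dom : ∀ {Γ x A} → (x , A) ∈ Γ → x ∈ dom Γ
  ∈-dom = ∈-map⁺ proj₁

  weaken : ∀ {Γ Δ M A} → Γ ⊢ M ∶ A → Γ ⊆ Δ → Δ ok → Δ ⊢ M ∶ A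
  weaken (sort _ a) Γ⊆Δ Δok = sort Δok a
  weaken (var _ x∈Γ) Γ⊆Δ Δok = var Δok (Γ⊆Δ x∈Γ)
  weaken (prod ⊢A ⊢B r) Γ⊆Δ Δok = prod ⊢A' ⊢B' r
    where
      ⊢A' = weaken ⊢A Γ⊆Δ Δok
      ⊢B' = λ y y∉Δ → weaken (⊢B y (λ y∈ → y∉Δ (map⁺ proj₁ Γ⊆Δ y∈))) (∷⁺ʳ _ Γ⊆Δ) (cons Δok ⊢A' y∉Δ)
  weaken (abs ⊢A ⊢B ⊢M r) Γ⊆Δ Δok = abs ⊢A' ⊢B' ⊢M' r
    where
      ⊢A' = weaken ⊢A Γ⊆Δ Δok
      ⊢B' = λ y y∉Δ → weaken (⊢B y (λ y∈ → y∉Δ (map⁺ proj₁ Γ⊆Δ y∈))) (∷⁺ʳ _ Γ⊆Δ) (cons Δok ⊢A' y∉Δ)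
      ⊢M' = λ y y∉Δ → weaken (⊢M y (λ y∈ → y∉Δ (map⁺ proj₁ Γ⊆Δ y∈))) (∷⁺ʳ _ Γ⊆Δ) (cons Δok ⊢A' y∉Δ)
  weaken (app ⊢M ⊢N ⊢B) Γ⊆Δ Δok = app (weaken ⊢M Γ⊆Δ Δok) (weaken ⊢N Γ⊆Δ Δok) (weaken ⊢B Γ⊆Δ Δok)
  weaken (conv ⊢M A≃B ⊢B) Γ⊆Δ Δok = conv (weaken ⊢M Γ⊆Δ Δok) A≃B (weaken ⊢B Γ⊆Δ Δok)

  infix 2 _⊢-vars_
  _⊢-vars_ : Context → Context → Set
  Δ ⊢-vars Γ = ∀ {x T} → (x , T) ∈ Γ → Δ ⊢ v x ∶ T

  ⊢-vars-extend : ∀ {Γ Δ y A} → Δ ⊢-vars Γ → (Δ ,, y ∶ A) ok → (Δ ,, y ∶ A) ⊢-vars (Γ ,, y ∶ A)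
  ⊢-vars-extend ⊢Γ Δ'ok (here refl) = var Δ'ok (here refl)
  ⊢-vars-extend ⊢Γ Δ'ok (there x∈Γ) = weaken (⊢Γ x∈Γ) there Δ'ok

  replace-context : ∀ {Γ Δ M A} → Γ ⊢ M ∶ A → dom Γ ⊆ dom Δ → Δ ⊢-vars Γ → Δ ok → Δ ⊢ M ∶ A
  replace-context (sort _ a) Γ⊆Δ ⊢Γ Δok = sort Δok a
  replace-context (var _ x∈Γ) Γ⊆Δ ⊢Γ Δok = ⊢Γ x∈Γ
  replace-context (prod ⊢A ⊢B r) Γ⊆Δ ⊢Γ Δok = prod ⊢A' ⊢B' r
    where
      ⊢A' = replace-context ⊢A Γ⊆Δ ⊢Γ Δok
      ⊢B' = λ y y∉Δ → let Δ'ok = cons Δok ⊢A' y∉Δ in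
        replace-context (⊢B y (λ y∈ → y∉Δ (Γ⊆Δ y∈))) (∷⁺ʳ _ Γ⊆Δ) (⊢-vars-extend ⊢Γ Δ'ok) Δ'ok
  replace-context (abs ⊢A ⊢B ⊢M r) Γ⊆Δ ⊢Γ Δok = abs ⊢A' ⊢B' ⊢M' r
    where
      ⊢A' = replace-context ⊢A Γ⊆Δ ⊢Γ Δok
      ⊢B' = λ y y∉Δ → let Δ'ok = cons Δok ⊢A' y∉Δ in
        replace-context (⊢B y (λ y∈ → y∉Δ (Γ⊆Δ y∈))) (∷⁺ʳ _ Γ⊆Δ) (⊢-vars-extend ⊢Γ Δ'ok) Δ'ok
      ⊢M' = λ y y∉Δ → let Δ'ok = cons Δok ⊢A' y∉Δ in
        replace-context (⊢M y (λ y∈ → y∉Δ (Γ⊆Δ y∈))) (∷⁺ʳ _ Γ⊆Δ) (⊢-vars-extend ⊢Γ Δ'ok) Δ'ok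
  replace-context (app ⊢M ⊢N ⊢B) Γ⊆Δ ⊢Γ Δok =
    app (replace-context ⊢M Γ⊆Δ ⊢Γ Δok) (replace-context ⊢N Γ⊆Δ ⊢Γ Δok) (replace-context ⊢B Γ⊆Δ ⊢Γ Δok)
  replace-context (conv ⊢M A≃B ⊢B) Γ⊆Δ ⊢Γ Δok =
    conv (replace-context ⊢M Γ⊆Δ ⊢Γ Δok) A≃B (replace-context ⊢B Γ⊆Δ ⊢Γ Δok)

  conv-context : ∀ {Γ z A A' M T s s'} → (Γ ,, z ∶ A) ⊢ M ∶ T → Γ ⊢ A ∶ c s → Γ ⊢ A' ∶ c s' → A' ≃β A →
                 (Γ ,, z ∶ A') ⊢ M ∶ T
  conv-context {Γ} {z} {A} {A'} ⊢M ⊢A ⊢A' A'≃A with ⊢-ok ⊢M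
  ... | cons Γok _ z∉Γ = replace-context ⊢M (λ x∈ → x∈) ⊢Γ' Γ'ok
    where
      Γ'ok : (Γ ,, z ∶ A') ok
      Γ'ok = cons Γok ⊢A' z∉Γ
      ⊢Γ' : (Γ ,, z ∶ A') ⊢-vars (Γ ,, z ∶ A)
      ⊢Γ' (here refl) = conv (var Γ'ok (here refl)) A'≃A (weaken ⊢A there Γ'ok)
      ⊢Γ' (there x∈Γ) = var Γ'ok (there x∈Γ)

  [:=]-cong-≈ : ∀ M x {N N'} → N ≈ N' → M [ x := N ] ≈ M [ x := N' ]
  [:=]-cong-≈ M x {N} {N'} N≈N' = •-cong-≈ M (λ {w} _ → extend-≈ w)
    where
      extend-≈ : ∀ w → (ι , x := N) w ≈ (ι , x := N') w
      extend-≈ w with w ≟ x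
      ... | yes _ = N≈N'
      ... | no _ = ≈-refl

  ⊢-resp-≈ : ∀ {Γ M A} → Γ ⊢ M ∶ A → ∀ M' → M ≈ M' → Γ ⊢ M' ∶ A
  ⊢-resp-≈ (conv ⊢M A≃B ⊢B) M' M≈M' = conv (⊢-resp-≈ ⊢M M' M≈M') A≃B ⊢B
  ⊢-resp-≈ (sort Γok a) (c k) (canonical refl) = sort Γok a
  ⊢-resp-≈ (var Γok x∈Γ) (v y) (canonical refl) = var Γok x∈Γ
  ⊢-resp-≈ (prod {Γ} {A = A} ⊢A ⊢B r) (Π[ x' ∶ A' ] B') M≈M' = prod ⊢A' ⊢B' r
    where
      A≈A' = proj₁ (Π-≈⁻ M≈M')
      ⊢A' = ⊢-resp-≈ ⊢A A' A≈A'
      ⊢B' = λ y y∉Γ → conv-context (subst (λ P → (Γ ,, y ∶ A) ⊢ P ∶ _) (≈ᵇ-[:=] (proj₂ (Π-≈⁻ M≈M')) y) (⊢B y y∉Γ))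
                                   ⊢A ⊢A' (≈⇒≃β (≈-sym A≈A'))
  ⊢-resp-≈ (abs {Γ} {y = y} {A} {B} ⊢A ⊢B ⊢M r) (ƛ[ x' ∶ A' ] M') M≈M' =
    conv (abs {y = y} {B = B} ⊢A' ⊢B' ⊢M' r) (≈⇒≃β (Π-≈ (≈-sym A≈A') (refl , refl))) (prod ⊢A ⊢B r)
    where
      A≈A' = proj₁ (ƛ-≈⁻ M≈M')
      ⊢A' = ⊢-resp-≈ ⊢A A' A≈A'
      ⊢B' = λ z z∉Γ → conv-context (⊢B z z∉Γ) ⊢A ⊢A' (≈⇒≃β (≈-sym A≈A'))
      ⊢M' = λ z z∉Γ → conv-context (subst (λ P → (Γ ,, z ∶ A) ⊢ P ∶ _) (≈ᵇ-[:=] (proj₂ (ƛ-≈⁻ M≈M')) z) (⊢M z z∉Γ))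
                                   ⊢A ⊢A' (≈⇒≃β (≈-sym A≈A'))
  ⊢-resp-≈ (app {x = x} {B = B} ⊢M ⊢N ⊢B[N]) (M' · N') MN≈M'N' =
    conv (app (⊢-resp-≈ ⊢M M' M≈M') (⊢-resp-≈ ⊢N N' N≈N') (⊢-resp-≈ ⊢B[N] _ B[N]≈B[N']))
         (≈⇒≃β (≈-sym B[N]≈B[N'])) ⊢B[N]
    where
      M≈M' = proj₁ (·-≈⁻ MN≈M'N')
      N≈N' = proj₂ (·-≈⁻ MN≈M'N')
      B[N]≈B[N'] = [:=]-cong-≈ B x N≈N'
  ⊢-resp-≈ (sort _ _) (v _) (canonical ())
  ⊢-resp-≈ (sort _ _) (ƛ[ _ ∶ _ ] _) (canonical ())
  ⊢-resp-≈ (sort _ _) (Π[ _ ∶ _ ] _) (canonical ())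
  ⊢-resp-≈ (sort _ _) (_ · _) (canonical ())
  ⊢-resp-≈ (var _ _) (c _) (canonical ())
  ⊢-resp-≈ (var _ _) (ƛ[ _ ∶ _ ] _) (canonical ())
  ⊢-resp-≈ (var _ _) (Π[ _ ∶ _ ] _) (canonical ())
  ⊢-resp-≈ (var _ _) (_ · _) (canonical ())
  ⊢-resp-≈ (prod _ _ _) (c _) (canonical ())
  ⊢-resp-≈ (prod _ _ _) (v _) (canonical ())
  ⊢-resp-≈ (prod _ _ _) (ƛ[ _ ∶ _ ] _) (canonical ())
  ⊢-resp-≈ (prod _ _ _) (_ · _) (canonical ())
  ⊢-resp-≈ (abs _ _ _ _) (c _) (canonical ())
  ⊢-resp-≈ (abs _ _ _ _) (v _) (canonical ())
  ⊢-resp-≈ (abs _ _ _ _) (Π[ _ ∶ _ ] _) (canonical ())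
  ⊢-resp-≈ (abs _ _ _ _) (_ · _) (canonical ())
  ⊢-resp-≈ (app _ _ _) (c _) (canonical ())
  ⊢-resp-≈ (app _ _ _) (v _) (canonical ())
  ⊢-resp-≈ (app _ _ _) (ƛ[ _ ∶ _ ] _) (canonical ())
  ⊢-resp-≈ (app _ _ _) (Π[ _ ∶ _ ] _) (canonical ())

  names : Context → List V
  names Γ = dom Γ ++ concatMap (λ p → fv (proj₂ p)) Γ

  ⇀-extend : ∀ {Γ Δ σ A y z} → σ ∶ Γ ⇀ Δ → y ∉ names Γ → y ∉ fv A → (Δ ,, z ∶ (A • σ)) ok →
             (σ , y := v z) ∶ (Γ ,, y ∶ A) ⇀ (Δ ,, z ∶ (A • σ))
  ⇀-extend {Δ = Δ} {σ} {A} {y} {z} σ⇀ y∉Γ y∉A Δ'ok (here refl) =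
    subst₂ (λ P T → (Δ ,, z ∶ (A • σ)) ⊢ P ∶ T) (sym (extend-≡ σ y (v z))) (sym (•-extend-∉ A σ y (v z) y∉A))
           (var Δ'ok (here refl))
  ⇀-extend {Γ} {Δ} {σ} {A} {y} {z} σ⇀ y∉Γ y∉A Δ'ok {x} {T} (there x∈Γ) =
    subst₂ (λ P T → (Δ ,, z ∶ (A • σ)) ⊢ P ∶ T) (sym (extend-≢ σ y (v z) x≢y)) (sym (•-extend-∉ T σ y (v z) y∉T))
           (weaken (σ⇀ x∈Γ) there Δ'ok)
    where
      x≢y : x ≢ y
      x≢y refl = y∉Γ (∈-++⁺ˡ (∈-dom x∈Γ))
      y∉T : y ∉ fv T
      y∉T y∈T = y∉Γ (∈-++⁺ʳ (dom Γ) (∈-concatMap⁺′ _ x∈Γ y∈T))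

  ⊢-• : ∀ {Γ Δ M A σ} → Γ ⊢ M ∶ A → σ ∶ Γ ⇀ Δ → Δ ok → Δ ⊢ M • σ ∶ A • σ
  ⊢-• (sort _ a) σ⇀ Δok = sort Δok a
  ⊢-• (var _ x∈Γ) σ⇀ Δok = σ⇀ x∈Γ
  ⊢-• {σ = σ} (conv ⊢M A≃B ⊢B) σ⇀ Δok = conv (⊢-• ⊢M σ⇀ Δok) (≃β-• σ A≃B) (⊢-• ⊢B σ⇀ Δok)
  ⊢-• {σ = σ} (app {N = N} {x} {B = B} ⊢M ⊢N ⊢B[N]) σ⇀ Δok =
    conv (app (⊢-• ⊢M σ⇀ Δok) (⊢-• ⊢N σ⇀ Δok) (⊢-resp-≈ ⊢B[N]σ _ B[N]σ≈)) (≈⇒≃β (≈-sym B[N]σ≈)) ⊢B[N]σ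
    where
      ⊢B[N]σ = ⊢-• ⊢B[N] σ⇀ Δok
      B[N]σ≈ = [:=]-•-≈ B x N σ
  ⊢-• {Γ} {Δ} {σ = σ} (prod {x = x} {A} {B} ⊢A ⊢B r) σ⇀ Δok = prod ⊢Aσ ⊢Bσ r
    where
      u = X' (names Γ ++ fv (Π[ x ∶ A ] B))
      u∉Γ : u ∉ names Γ
      u∉Γ = X'-∉-⊆ ∈-++⁺ˡ
      u∉A : u ∉ fv A
      u∉A = X'-∉-⊆ (λ u∈ → ∈-++⁺ʳ (names Γ) (∈-++⁺ˡ u∈))
      u∉B : u ∉ fv B - x
      u∉B = X'-∉-⊆ (λ u∈ → ∈-++⁺ʳ (names Γ) (∈-++⁺ʳ (fv A) u∈))
      ⊢Aσ = ⊢-• ⊢A σ⇀ Δok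
      ⊢Bσ = λ z z∉Δ → let Δ'ok = cons Δok ⊢Aσ z∉Δ in
        ⊢-resp-≈ (⊢-• (⊢B u (λ u∈ → u∉Γ (∈-++⁺ˡ u∈))) (⇀-extend σ⇀ u∉Γ u∉A Δ'ok) Δ'ok) _ (rename-•-≈ B x u σ z u∉B)
  ⊢-• {Γ} {Δ} {σ = σ} (abs {x = x} {y} {A} {B} {M} ⊢A ⊢B ⊢M r) σ⇀ Δok = abs ⊢Aσ ⊢Bσ ⊢Mσ r
    where
      u = X' (names Γ ++ fv (Π[ y ∶ A ] B) ++ fv (ƛ[ x ∶ A ] M))
      u∉Γ : u ∉ names Γ
      u∉Γ = X'-∉-⊆ ∈-++⁺ˡ
      u∉A : u ∉ fv A
      u∉A = X'-∉-⊆ (λ u∈ → ∈-++⁺ʳ (names Γ) (∈-++⁺ˡ (∈-++⁺ˡ u∈)))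
      u∉B : u ∉ fv B - y
      u∉B = X'-∉-⊆ (λ u∈ → ∈-++⁺ʳ (names Γ) (∈-++⁺ˡ (∈-++⁺ʳ (fv A) u∈)))
      u∉M : u ∉ fv M - x
      u∉M = X'-∉-⊆ (λ u∈ → ∈-++⁺ʳ (names Γ) (∈-++⁺ʳ (fv (Π[ y ∶ A ] B)) (∈-++⁺ʳ (fv A) u∈)))
      ⊢Aσ = ⊢-• ⊢A σ⇀ Δok
      σ⁺ : ∀ {z} → z ∉ dom Δ → (σ , u := v z) ∶ (Γ ,, u ∶ A) ⇀ (Δ ,, z ∶ (A • σ))
      σ⁺ z∉Δ = ⇀-extend σ⇀ u∉Γ u∉A (cons Δok ⊢Aσ z∉Δ)
      ⊢Bσ = λ z z∉Δ →
        ⊢-resp-≈ (⊢-• (⊢B u (λ u∈ → u∉Γ (∈-++⁺ˡ u∈))) (σ⁺ z∉Δ) (cons Δok ⊢Aσ z∉Δ)) _ (rename-•-≈ B y u σ z u∉B)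
      ⊢Mσ = λ z z∉Δ →
        conv (⊢-resp-≈ (⊢-• (⊢M u (λ u∈ → u∉Γ (∈-++⁺ˡ u∈))) (σ⁺ z∉Δ) (cons Δok ⊢Aσ z∉Δ))
                       _ (rename-•-≈ M x u σ z u∉M))
             (≈⇒≃β (rename-•-≈ B y u σ z u∉B)) (⊢Bσ z z∉Δ)

lemma20 : (V : Set) (_≟_ : DecidableEquality V)
          (encode : V → ℕ) (decode : ℕ → V)
          (encode-decode : ∀ n → encode (decode n) ≡ n)
          (C : Set)
          (χ' : List ℕ → ℕ) (χ'-fresh : ∀ ns → χ' ns ∉ ns)
          (𝒜 : C → C → Set) (ℛ : C → C → C → Set) →
          let open PTS V _≟_ encode decode encode-decode C χ' χ'-fresh 𝒜 ℛ in
          ∀ (Γ Δ : Context) (M A : Λ) (σ : Subst) →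
          σ ∶ Γ ⇀ Δ → Δ ok → Γ ⊢ M ∶ A → Δ ⊢ M • σ ∶ A • σ
lemma20 V _≟_ encode decode encode-decode C χ' χ'-fresh 𝒜 ℛ Γ Δ M A σ σ⇀ Δok ⊢M =
  Substitution.⊢-• V _≟_ encode decode encode-decode C χ' χ'-fresh 𝒜 ℛ ⊢M σ⇀ Δok
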